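{- Let $\varepsilon>0$ and let $\mathcal{M}'_1=(\mathcal{N}',\mathcal{I}'_1,w)$, $\mathcal{M}'_2=(\mathcal{N}',\mathcal{I}'_2,w)$ be an $\varepsilon^{ -1}$-spread weighted matroid intersection instance with intervals $L_j=[l_j,r_j]$, $j\in[k]$. For each $j\in[k]$ let $I'_j$ be a common independent set of $\mathcal{M}'_1|L_j$ and $\mathcal{M}'_2|L_j$. Let $I_{\mathrm{merge}}$ be obtained by greedily combining the $I'_j$: starting from $I_{\mathrm{merge}}=\emptyset$, process the sets $I'_j$ in descending order of intervals ($j=k,k-1,\dots,1$), and add each element $e$ of the current set to $I_{\mathrm{merge}}$ if and only if $I_{\mathrm{merge}}\cup\{e\}$ is a common independent set of $\mathcal{M}'_1,\mathcal{M}'_2$. Then $w(I_{\mathrm{merge}})\ge(1-4\varepsilon)\sum_{j=1}^k w(I'_j)$.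
   Context: $\varepsilon^{ -1}$-spread: there are disjoint weight intervals $[l_1,r_1],\dots,[l_k,r_k]$ with $l_{i+1}>r_i\varepsilon^{ -1}$ such that the sets $\mathcal{N}'_i=\{e\in\mathcal{N}': w(e)\in[l_i,r_i]\}$ partition $\mathcal{N}'$. For a matroid $\mathcal{M}'$ and interval $L_j$, $\mathcal{M}'|L_j$ is the restriction of $\mathcal{M}'$ to $\{e: w(e)\in L_j\}$ (independent sets are the independent sets contained in that set). $w(S)=\sum_{e\in S}w(e)$; weights are positive reals.
   Formalization: The weights, the parameter ε and the interval endpoints $l_j$ and $r_j$ are rational rather than real. -}

module Defs where

open import Level using (0ℓ)
open import Data.Nat using (ℕ; zero; suc)
open import Data.Fin using (Fin; zero; suc; toℕ)
open import Data.Fin.Subset using (Subset; _∈_; _∉_; _⊆_; _∪_; ⁅_⁆; ∣_∣; ⊥)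
open import Data.Vec using (lookup)
open import Data.Bool using (true; false)
open import Data.List using (List; []; _∷_)
open import Data.Product using (Σ; ∃; _×_; _,_)
open import Data.Rational using (ℚ; 0ℚ; _+_)
open import Relation.Nullary using (¬_)
import Data.Nat as ℕ

record Matroid (n : ℕ) : Set₁ where
  field
    Indep      : Subset n → Set
    indep-∅    : Indep ⊥
    indep-⊆    : ∀ {A B} → A ⊆ B → Indep B → Indep A
    indep-exch : ∀ {A B} → Indep A → Indep B → ∣ A ∣ ℕ.< ∣ B ∣ →
                 Σ (Fin n) λ x → x ∈ B × x ∉ A × Indep (A ∪ ⁅ x ⁆)
open Matroid public

IndepRestr : ∀ {n} → Matroid n → Subset n → Subset n → Set
IndepRestr M P S = Indep M S × S ⊆ P

CommonIndep : ∀ {n} → Matroid n → Matroid n → Subset n → Set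
CommonIndep M₁ M₂ S = Indep M₁ S × Indep M₂ S

ΣFin : ∀ n → (Fin n → ℚ) → ℚ
ΣFin zero    f = 0ℚ
ΣFin (suc n) f = f zero + ΣFin n (λ i → f (suc i))

weight : ∀ {n} → (Fin n → ℚ) → Subset n → ℚ
weight {n} w S = ΣFin n (λ i → sel (lookup S i) i)
  where
    sel : _ → Fin n → ℚ
    sel true  i = w i
    sel false i = 0ℚ

data Greedy {n} (M₁ M₂ : Matroid n) : Subset n → List (Fin n) → Subset n → Set where
  done : ∀ {S} → Greedy M₁ M₂ S [] S
  add  : ∀ {S e es T} → CommonIndep M₁ M₂ (S ∪ ⁅ e ⁆) →
         Greedy M₁ M₂ (S ∪ ⁅ e ⁆) es T → Greedy M₁ M₂ S (e ∷ es) T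
  skip : ∀ {S e es T} → ¬ CommonIndep M₁ M₂ (S ∪ ⁅ e ⁆) →
         Greedy M₁ M₂ S es T → Greedy M₁ M₂ S (e ∷ es) T

InInterval : ∀ {n} → (Fin n → ℚ) → ℚ → ℚ → Subset n → Set
InInterval w l r P = ∀ e → (e ∈ P → (l Data.Rational.≤ w e × w e Data.Rational.≤ r))
                         × ((l Data.Rational.≤ w e × w e Data.Rational.≤ r) → e ∈ P)

{-# OPTIONS --safe #-}
-- A charging argument with e = 4ε, processing the blocks from the top down (l and r
-- replaced by their positive parts). After the blocks down to interval j, the greedy
-- set T pays for their total weight A with (1 + e) times its own weight while every
-- element of T keeps a reserve e l_j:  A ≤ Σ_{x ∈ T} ((1 + e) w(x) − e l_j).
-- On the next block I, greedy adds some N ⊆ I and stops at a T′ into which no further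
-- element of I fits. The exchange property in both matroids gives |I| + |I ∩ T′| ≤ 2|T′|,
-- so at most 2|T| elements of I are rejected or already present. Each weighs at most
-- r_{j-1}, and the spread gives 2 r_{j-1} + e l_{j-1} ≤ e l_j, so the reserves on T pay for
-- them, while an added element x pays for itself because e l_{j-1} ≤ e w(x). At the end
-- A ≤ (1 + e) w(I_merge), hence (1 − e) A ≤ w(I_merge).
module Submission where

open import Defs
open import Data.Nat using (ℕ; suc)
open import Data.Fin using (Fin; toℕ)
open import Data.Fin.Subset using (Subset; _∈_; ⊥)
open import Data.List using (List; concat; map; reverse; allFin)
open import Data.List.Membership.Propositional using () renaming (_∈_ to _∈ₗ_)
open import Data.Product using (Σ; _×_)
open import Relation.Binary.PropositionalEquality using (_≡_)
open import Data.Integer using (+_)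
open import Data.Rational using (ℚ; 0ℚ; 1ℚ; _+_; _-_; _*_; _/_; _≤_; _<_; _≥_)

open import Level using (0ℓ)
open import Function using (_∘_; id; flip)
open import Data.Bool using (true; false; if_then_else_)
open import Data.Sum using (_⊎_; inj₁; inj₂; [_,_]′; map₁)
open import Data.Product using (_,_; proj₁; proj₂)
open import Data.Fin using (zero; suc)
open import Data.Fin.Subset using (inside; outside; _∉_; _⊆_; _∪_; _∩_; _─_; ∁; ⁅_⁆; ∣_∣)
open import Data.Fin.Subset.Properties
  using (drop-there; drop-∷-⊆; p⊆q⇒∣p∣≤∣q∣; p∩q⊆p; p─q⊆p; x∈p∩q⁺; x∈p∩q⁻; x∈p∪q⁺; x∈p∪q⁻;
         p⊆p∪q; x∈⁅x⁆; x∈⁅y⁆⇒x≡y; x∈∁p⇒x∉p)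
open import Data.Vec using ([]; _∷_; lookup; tabulate; here; there)
open import Data.Vec.Properties using ([]=⇒lookup; lookup⇒[]=; lookup∘tabulate)
open import Data.List using ([]; _∷_; _++_; _∷ʳ_) renaming (tabulate to tabulateₗ)
open import Data.List.Properties
  using (unfold-reverse; reverse-map; map-tabulate; map-++; concat-++; ++-identityʳ)
open import Data.List.Relation.Unary.Any using (here; there)
open import Data.Rational using (_⊔_; -_; nonNegative; +-0-rawMonoid)
open import Data.Rational.Properties
  using (≤-refl; ≤-trans; ≤-reflexive; <⇒≤; ≰⇒>; _≤?_; _≟_;
         +-assoc; +-comm; +-identityˡ; +-identityʳ; +-inverseʳ; +-mono-≤; +-monoˡ-≤; +-monoʳ-≤;
         neg-antimono-≤; *-zeroˡ; *-zeroʳ; *-identityˡ; *-distribˡ-+;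
         *-monoˡ-≤-nonNeg; *-monoʳ-≤-nonNeg; nonNeg*nonNeg⇒nonNeg; nonNegative⁻¹; positive⁻¹;
         ⊔-lub; ⊔-monoˡ-≤; p≤p⊔q; p≤q⊔p;
         +-*-commutativeRing; +-0-monoid; +-0-commutativeMonoid; module ≤-Reasoning)
open import Algebra.Bundles using (CommutativeMonoid)
open import Algebra.Definitions.RawMonoid +-0-rawMonoid using () renaming (_×_ to _×′_)
open import Algebra.Properties.Monoid.Mult +-0-monoid using (×-homo-+)
open import Algebra.Properties.CommutativeSemigroup
  (CommutativeMonoid.commutativeSemigroup +-0-commutativeMonoid) using (interchange; x∙yz≈y∙xz)
open import Data.Nat as ℕ using (zero)
import Data.Nat.Properties as ℕₚ
open import Algebra.Properties.CommutativeSemigroup ℕₚ.+-commutativeSemigroup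
  using () renaming (interchange to ℕ-interchange)
open import Relation.Binary.PropositionalEquality
  using (refl; sym; trans; cong; cong₂; subst; module ≡-Reasoning)
open import Relation.Nullary using (¬_; Dec; yes; no; does; proof; contradiction)
open import Relation.Nullary.Reflects using (Reflects; invert)
open import Relation.Nullary.Decidable using (dec-true; decidable-stable; ¬¬-excluded-middle)
open import Relation.Nullary.Decidable.Core using (dec⇒maybe)
open import Relation.Nullary.Negation using (¬¬-map)
open import Tactic.RingSolver using (solve-∀)
open import Tactic.RingSolver.Core.AlmostCommutativeRing
  using (AlmostCommutativeRing; fromCommutativeRing)

private
  variable
    n : ℕ
    x : Fin n

ΣFin-nonneg : ∀ n {f : Fin n → ℚ} → (∀ i → 0ℚ ≤ f i) → 0ℚ ≤ ΣFin n f
ΣFin-nonneg zero    _   = ≤-refl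
ΣFin-nonneg (suc n) 0≤f = +-mono-≤ (0≤f zero) (ΣFin-nonneg n (0≤f ∘ suc))

ΣFin-cong : ∀ n {f g : Fin n → ℚ} → (∀ i → f i ≡ g i) → ΣFin n f ≡ ΣFin n g
ΣFin-cong zero    _   = refl
ΣFin-cong (suc n) f≡g = cong₂ _+_ (f≡g zero) (ΣFin-cong n (f≡g ∘ suc))

sumOn : Subset n → (Fin n → ℚ) → ℚ
sumOn []            _ = 0ℚ
sumOn (inside  ∷ S) f = f zero + sumOn S (f ∘ suc)
sumOn (outside ∷ S) f = sumOn S (f ∘ suc)

ΣFin-if≡sumOn : ∀ (S : Subset n) f → ΣFin n (λ i → if lookup S i then f i else 0ℚ) ≡ sumOn S f
ΣFin-if≡sumOn []            _ = refl
ΣFin-if≡sumOn (inside  ∷ S) f = cong (_+_ (f zero)) (ΣFin-if≡sumOn S (f ∘ suc))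
ΣFin-if≡sumOn (outside ∷ S) f = trans (+-identityˡ _) (ΣFin-if≡sumOn S (f ∘ suc))

-- The summand of weight is a where-bound function of its definition and cannot be
-- named, so the left-hand side of weight-summand is left to unification.
mutual
  weight≡sumOn : ∀ (f : Fin n → ℚ) S → weight f S ≡ sumOn S f
  weight≡sumOn {n} f S = trans (ΣFin-cong n (weight-summand f S)) (ΣFin-if≡sumOn S f)

  weight-summand : ∀ (f : Fin n → ℚ) S i → _ ≡ (if lookup S i then f i else 0ℚ)
  weight-summand f S i with lookup S i
  ... | true  = refl
  ... | false = refl

sumOn-⊥ : ∀ (f : Fin n → ℚ) → sumOn ⊥ f ≡ 0ℚ
sumOn-⊥ {zero}  _ = refl
sumOn-⊥ {suc n} f = sumOn-⊥ (f ∘ suc)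

sumOn-mono : ∀ (S : Subset n) {f g} → (∀ {x} → x ∈ S → f x ≤ g x) → sumOn S f ≤ sumOn S g
sumOn-mono []            _   = ≤-refl
sumOn-mono (inside  ∷ S) f≤g = +-mono-≤ (f≤g here) (sumOn-mono S (f≤g ∘ there))
sumOn-mono (outside ∷ S) f≤g = sumOn-mono S (f≤g ∘ there)

sumOn-nonneg : ∀ (S : Subset n) {f} → (∀ {x} → x ∈ S → 0ℚ ≤ f x) → 0ℚ ≤ sumOn S f
sumOn-nonneg []            _   = ≤-refl
sumOn-nonneg (inside  ∷ S) 0≤f = +-mono-≤ (0≤f here) (sumOn-nonneg S (0≤f ∘ there))
sumOn-nonneg (outside ∷ S) 0≤f = sumOn-nonneg S (0≤f ∘ there)

weight-nonneg : ∀ {w : Fin n → ℚ} → (∀ x → 0ℚ < w x) → ∀ S → 0ℚ ≤ weight w S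
weight-nonneg {w = w} 0<w S =
  subst (0ℚ ≤_) (sym (weight≡sumOn w S)) (sumOn-nonneg S λ {x} _ → <⇒≤ (0<w x))

sumOn-+ : ∀ (S : Subset n) {f g} → sumOn S (λ x → f x + g x) ≡ sumOn S f + sumOn S g
sumOn-+ []                  = refl
sumOn-+ (inside  ∷ S) {f} {g} =
  trans (cong (_+_ (f zero + g zero)) (sumOn-+ S)) (interchange (f zero) (g zero) _ _)
sumOn-+ (outside ∷ S)       = sumOn-+ S

sumOn-* : ∀ (S : Subset n) a {f} → sumOn S (λ x → a * f x) ≡ a * sumOn S f
sumOn-* []            a     = sym (*-zeroʳ a)
sumOn-* (inside  ∷ S) a {f} = trans (cong (_+_ (a * f zero)) (sumOn-* S a)) (sym (*-distribˡ-+ a _ _))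
sumOn-* (outside ∷ S) a     = sumOn-* S a

sumOn-const : ∀ (S : Subset n) c → sumOn S (λ _ → c) ≡ ∣ S ∣ ×′ c
sumOn-const []            _ = refl
sumOn-const (inside  ∷ S) c = cong (_+_ c) (sumOn-const S c)
sumOn-const (outside ∷ S) c = sumOn-const S c

sumOn-⊆-split : ∀ (S R : Subset n) {f} → R ⊆ S → sumOn S f ≡ sumOn R f + sumOn (S ─ R) f
sumOn-⊆-split []            []                _   = sym (+-identityˡ 0ℚ)
sumOn-⊆-split (inside  ∷ S) (inside  ∷ R) {f} R⊆S =
  trans (cong (_+_ (f zero)) (sumOn-⊆-split S R (drop-∷-⊆ R⊆S)))
        (sym (+-assoc (f zero) (sumOn R (f ∘ suc)) _))
sumOn-⊆-split (inside  ∷ S) (outside ∷ R) {f} R⊆S =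
  trans (cong (_+_ (f zero)) (sumOn-⊆-split S R (drop-∷-⊆ R⊆S)))
        (x∙yz≈y∙xz (f zero) (sumOn R (f ∘ suc)) _)
sumOn-⊆-split (outside ∷ S) (inside  ∷ R)     R⊆S = contradiction (R⊆S here) λ ()
sumOn-⊆-split (outside ∷ S) (outside ∷ R)     R⊆S = sumOn-⊆-split S R (drop-∷-⊆ R⊆S)

×′-nonneg : ∀ m {c} → 0ℚ ≤ c → 0ℚ ≤ m ×′ c
×′-nonneg zero    _   = ≤-refl
×′-nonneg (suc m) 0≤c = +-mono-≤ 0≤c (×′-nonneg m 0≤c)

×′-monoˡ-≤ : ∀ {m m′ c} → 0ℚ ≤ c → m ℕ.≤ m′ → m ×′ c ≤ m′ ×′ c
×′-monoˡ-≤ {m′ = m′} 0≤c ℕ.z≤n     = ×′-nonneg m′ 0≤c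
×′-monoˡ-≤ {c = c}   0≤c (ℕ.s≤s m≤m′) = +-monoʳ-≤ c (×′-monoˡ-≤ 0≤c m≤m′)

x∈p─q⇒x∉q : ∀ (p q : Subset n) → x ∈ p ─ q → x ∉ q
x∈p─q⇒x∉q              (inside  ∷ p) (outside ∷ q) here          = λ ()
x∈p─q⇒x∉q {x = zero}   (outside ∷ p) (outside ∷ q) ()
x∈p─q⇒x∉q              (_       ∷ p) (_       ∷ q) (there x∈p─q) = x∈p─q⇒x∉q p q x∈p─q ∘ drop-there

∣p∣≡∣q∣+∣p─q∣ : ∀ (p q : Subset n) → q ⊆ p → ∣ p ∣ ≡ ∣ q ∣ ℕ.+ ∣ p ─ q ∣
∣p∣≡∣q∣+∣p─q∣ []            []            _   = refl
∣p∣≡∣q∣+∣p─q∣ (inside  ∷ p) (inside  ∷ q) q⊆p = cong suc (∣p∣≡∣q∣+∣p─q∣ p q (drop-∷-⊆ q⊆p))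
∣p∣≡∣q∣+∣p─q∣ (inside  ∷ p) (outside ∷ q) q⊆p =
  trans (cong suc (∣p∣≡∣q∣+∣p─q∣ p q (drop-∷-⊆ q⊆p))) (sym (ℕₚ.+-suc ∣ q ∣ _))
∣p∣≡∣q∣+∣p─q∣ (outside ∷ p) (inside  ∷ q) q⊆p = contradiction (q⊆p here) λ ()
∣p∣≡∣q∣+∣p─q∣ (outside ∷ p) (outside ∷ q) q⊆p = ∣p∣≡∣q∣+∣p─q∣ p q (drop-∷-⊆ q⊆p)

∣p∩[q∪∁r]∣+∣p∩[q∪r]∣≡∣p∣+∣p∩q∣ : ∀ (p q r : Subset n) →
  ∣ p ∩ (q ∪ ∁ r) ∣ ℕ.+ ∣ p ∩ (q ∪ r) ∣ ≡ ∣ p ∣ ℕ.+ ∣ p ∩ q ∣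
∣p∩[q∪∁r]∣+∣p∩[q∪r]∣≡∣p∣+∣p∩q∣ []            []            []            = refl
∣p∩[q∪∁r]∣+∣p∩[q∪r]∣≡∣p∣+∣p∩q∣ (outside ∷ p) (_       ∷ q) (_       ∷ r) =
  ∣p∩[q∪∁r]∣+∣p∩[q∪r]∣≡∣p∣+∣p∩q∣ p q r
∣p∩[q∪∁r]∣+∣p∩[q∪r]∣≡∣p∣+∣p∩q∣ (inside  ∷ p) (inside  ∷ q) (_       ∷ r) = cong suc (begin
  ∣ p ∩ (q ∪ ∁ r) ∣ ℕ.+ suc ∣ p ∩ (q ∪ r) ∣ ≡⟨ ℕₚ.+-suc _ _ ⟩
  suc (∣ p ∩ (q ∪ ∁ r) ∣ ℕ.+ ∣ p ∩ (q ∪ r) ∣) ≡⟨ cong suc (∣p∩[q∪∁r]∣+∣p∩[q∪r]∣≡∣p∣+∣p∩q∣ p q r) ⟩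
  suc (∣ p ∣ ℕ.+ ∣ p ∩ q ∣)                   ≡⟨ ℕₚ.+-suc _ _ ⟨
  ∣ p ∣ ℕ.+ suc ∣ p ∩ q ∣                     ∎)
  where open ≡-Reasoning
∣p∩[q∪∁r]∣+∣p∩[q∪r]∣≡∣p∣+∣p∩q∣ (inside  ∷ p) (outside ∷ q) (inside  ∷ r) =
  trans (ℕₚ.+-suc _ _) (cong suc (∣p∩[q∪∁r]∣+∣p∩[q∪r]∣≡∣p∣+∣p∩q∣ p q r))
∣p∩[q∪∁r]∣+∣p∩[q∪r]∣≡∣p∣+∣p∩q∣ (inside  ∷ p) (outside ∷ q) (outside ∷ r) =
  cong suc (∣p∩[q∪∁r]∣+∣p∩[q∪r]∣≡∣p∣+∣p∩q∣ p q r)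

∣p─[q─r]∣≤∣r∣+∣r∣ : ∀ (p q r : Subset n) → r ⊆ q → q ─ r ⊆ p →
  ∣ p ∣ ℕ.+ ∣ p ∩ q ∣ ℕ.≤ ∣ q ∣ ℕ.+ ∣ q ∣ → ∣ p ─ (q ─ r) ∣ ℕ.≤ ∣ r ∣ ℕ.+ ∣ r ∣
∣p─[q─r]∣≤∣r∣+∣r∣ p q r r⊆q q─r⊆p bound = ℕₚ.+-cancelʳ-≤ (d ℕ.+ d) a (∣ r ∣ ℕ.+ ∣ r ∣) (begin
  a ℕ.+ (d ℕ.+ d)                       ≡⟨ ℕₚ.+-assoc a d d ⟨
  a ℕ.+ d ℕ.+ d                         ≡⟨ cong (ℕ._+ d) (ℕₚ.+-comm a d) ⟩
  d ℕ.+ a ℕ.+ d                         ≤⟨ ℕₚ.+-monoʳ-≤ (d ℕ.+ a) (p⊆q⇒∣p∣≤∣q∣ q─r⊆p∩q) ⟩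
  d ℕ.+ a ℕ.+ ∣ p ∩ q ∣                 ≡⟨ cong (ℕ._+ ∣ p ∩ q ∣) (∣p∣≡∣q∣+∣p─q∣ p (q ─ r) q─r⊆p) ⟨
  ∣ p ∣ ℕ.+ ∣ p ∩ q ∣                   ≤⟨ bound ⟩
  ∣ q ∣ ℕ.+ ∣ q ∣                       ≡⟨ cong₂ ℕ._+_ ∣q∣ ∣q∣ ⟩
  (∣ r ∣ ℕ.+ d) ℕ.+ (∣ r ∣ ℕ.+ d)       ≡⟨ ℕ-interchange (∣ r ∣) d (∣ r ∣) d ⟩
  (∣ r ∣ ℕ.+ ∣ r ∣) ℕ.+ (d ℕ.+ d)       ∎)
  where
  open ℕₚ.≤-Reasoning
  a d : ℕ
  a = ∣ p ─ (q ─ r) ∣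
  d = ∣ q ─ r ∣
  ∣q∣ : ∣ q ∣ ≡ ∣ r ∣ ℕ.+ d
  ∣q∣ = ∣p∣≡∣q∣+∣p─q∣ q r r⊆q
  q─r⊆p∩q : q ─ r ⊆ p ∩ q
  q─r⊆p∩q x∈q─r = x∈p∩q⁺ (q─r⊆p x∈q─r , p─q⊆p q r x∈q─r)

-- Matroid intersection

unaugmentable⇒∣A∣≤∣T∣ : ∀ (M : Matroid n) {A T} → Indep M A → Indep M T →
  (∀ {x} → x ∈ A → x ∉ T → ¬ Indep M (T ∪ ⁅ x ⁆)) → ∣ A ∣ ℕ.≤ ∣ T ∣
unaugmentable⇒∣A∣≤∣T∣ M A-indep T-indep unaugmentable = ℕₚ.≮⇒≥ λ ∣T∣<∣A∣ →
  let x , x∈A , x∉T , T+x-indep = indep-exch M T-indep A-indep ∣T∣<∣A∣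
  in  unaugmentable x∈A x∉T T+x-indep

¬¬-decidable : ∀ n (P : Fin n → Set) → ¬ ¬ (∀ x → Dec (P x))
¬¬-decidable zero    _ never = never λ ()
¬¬-decidable (suc n) P never = ¬¬-excluded-middle λ P₀? →
  ¬¬-decidable n (P ∘ suc) λ P₊? → never λ { zero → P₀? ; (suc x) → P₊? x }

module _ {P : Fin n → Set} (P? : ∀ x → Dec (P x)) where

  ∈-tabulate-does⁻ : x ∈ tabulate (does ∘ P?) → P x
  ∈-tabulate-does⁻ {x} x∈ =
    invert (subst (Reflects (P x)) does≡true (proof (P? x)))
    where
    does≡true : does (P? x) ≡ true
    does≡true = trans (sym (lookup∘tabulate (does ∘ P?) x)) ([]=⇒lookup x∈)

  ∈-tabulate-does⁺ : P x → x ∈ tabulate (does ∘ P?)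
  ∈-tabulate-does⁺ {x} Px = lookup⇒[]= x _ (trans (lookup∘tabulate (does ∘ P?) x) (dec-true (P? x) Px))

-- D is the set of x with T ∪ ⁅ x ⁆ independent in M₁. Then I ∩ (T ∪ ∁ D) and
-- I ∩ (T ∪ D) are independent sets that cannot augment T in M₁, resp. M₂. The
-- predicate defining D is only ¬¬-decidable, which suffices for a goal in ℕ.
maximal⇒∣I∣+∣I∩T∣≤∣T∣+∣T∣ : ∀ (M₁ M₂ : Matroid n) {I T} →
  CommonIndep M₁ M₂ I → CommonIndep M₁ M₂ T →
  (∀ {x} → x ∈ I → x ∉ T → ¬ CommonIndep M₁ M₂ (T ∪ ⁅ x ⁆)) →
  ∣ I ∣ ℕ.+ ∣ I ∩ T ∣ ℕ.≤ ∣ T ∣ ℕ.+ ∣ T ∣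
maximal⇒∣I∣+∣I∩T∣≤∣T∣+∣T∣ {n} M₁ M₂ {I} {T} (I₁ , I₂) (T₁ , T₂) maximal =
  decidable-stable (_ ℕ.≤? _) (¬¬-map bound (¬¬-decidable n (λ x → Indep M₁ (T ∪ ⁅ x ⁆))))
  where
  bound : (∀ x → Dec (Indep M₁ (T ∪ ⁅ x ⁆))) → ∣ I ∣ ℕ.+ ∣ I ∩ T ∣ ℕ.≤ ∣ T ∣ ℕ.+ ∣ T ∣
  bound augments₁? = begin
    ∣ I ∣ ℕ.+ ∣ I ∩ T ∣                    ≡⟨ ∣p∩[q∪∁r]∣+∣p∩[q∪r]∣≡∣p∣+∣p∩q∣ I T D ⟨
    ∣ I ∩ (T ∪ ∁ D) ∣ ℕ.+ ∣ I ∩ (T ∪ D) ∣  ≤⟨ ℕₚ.+-mono-≤ blocked₁ blocked₂ ⟩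
    ∣ T ∣ ℕ.+ ∣ T ∣                        ∎
    where
    open ℕₚ.≤-Reasoning
    D : Subset n
    D = tabulate (does ∘ augments₁?)
    outside-T : ∀ {x S} → x ∈ I ∩ (T ∪ S) → x ∉ T → x ∈ S
    outside-T {S = S} x∈ x∉T = [ flip contradiction x∉T , id ]′ (x∈p∪q⁻ T S (proj₂ (x∈p∩q⁻ I _ x∈)))
    blocked₁ : ∣ I ∩ (T ∪ ∁ D) ∣ ℕ.≤ ∣ T ∣
    blocked₁ = unaugmentable⇒∣A∣≤∣T∣ M₁ (indep-⊆ M₁ (p∩q⊆p I _) I₁) T₁ λ x∈ x∉T →
      x∈∁p⇒x∉p (outside-T x∈ x∉T) ∘ ∈-tabulate-does⁺ augments₁?
    blocked₂ : ∣ I ∩ (T ∪ D) ∣ ℕ.≤ ∣ T ∣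
    blocked₂ = unaugmentable⇒∣A∣≤∣T∣ M₂ (indep-⊆ M₂ (p∩q⊆p I _) I₂) T₂ λ x∈ x∉T T+x₂ →
      maximal (p∩q⊆p I _ x∈) x∉T (∈-tabulate-does⁻ augments₁? (outside-T x∈ x∉T) , T+x₂)

-- Greedy runs

module _ {M₁ M₂ : Matroid n} where

  greedy-++ : ∀ {S T} xs ys → Greedy M₁ M₂ S (xs ++ ys) T →
              Σ (Subset n) λ U → Greedy M₁ M₂ S xs U × Greedy M₁ M₂ U ys T
  greedy-++ []       ys run = _ , done , run
  greedy-++ (_ ∷ xs) ys (add S+x-common run) =
    let U , run₁ , run₂ = greedy-++ xs ys run in U , add S+x-common run₁ , run₂
  greedy-++ (_ ∷ xs) ys (skip S+x-dependent run) =
    let U , run₁ , run₂ = greedy-++ xs ys run in U , skip S+x-dependent run₁ , run₂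

  record GreedyOutcome (S : Subset n) (xs : List (Fin n)) (T : Subset n) : Set where
    field
      grows    : S ⊆ T
      new-from : ∀ {x} → x ∈ T → x ∈ S ⊎ x ∈ₗ xs
      common   : CommonIndep M₁ M₂ T
      rejected : ∀ {x} → x ∈ₗ xs → x ∉ T → ¬ CommonIndep M₁ M₂ (T ∪ ⁅ x ⁆)

  common-⊆ : ∀ {A B} → A ⊆ B → CommonIndep M₁ M₂ B → CommonIndep M₁ M₂ A
  common-⊆ A⊆B (B₁ , B₂) = indep-⊆ M₁ A⊆B B₁ , indep-⊆ M₂ A⊆B B₂

  greedy-outcome : ∀ {S xs T} → CommonIndep M₁ M₂ S → Greedy M₁ M₂ S xs T → GreedyOutcome S xs T
  greedy-outcome S-common done = record
    { grows = id ; new-from = inj₁ ; common = S-common ; rejected = λ () }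
  greedy-outcome {S} _ (add {e = e} S+e-common run) = record
    { grows    = grows ∘ p⊆p∪q ⁅ e ⁆
    ; new-from = [ [ inj₁ , inj₂ ∘ here ∘ x∈⁅y⁆⇒x≡y e ]′ ∘ x∈p∪q⁻ S ⁅ e ⁆ , inj₂ ∘ there ]′ ∘ new-from
    ; common   = common
    ; rejected = λ { (here refl) e∉T → contradiction (grows (x∈p∪q⁺ (inj₂ (x∈⁅x⁆ e)))) e∉T
                   ; (there x∈xs) → rejected x∈xs }
    }
    where open GreedyOutcome (greedy-outcome S+e-common run)
  greedy-outcome {S} S-common (skip {e = e} S+e-dependent run) = record
    { grows    = grows
    ; new-from = [ inj₁ , inj₂ ∘ there ]′ ∘ new-from
    ; common   = common
    ; rejected = λ { (here refl) _ T+e-common → S+e-dependent (common-⊆ S+e⊆T+e T+e-common)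
                   ; (there x∈xs) → rejected x∈xs }
    }
    where
    open GreedyOutcome (greedy-outcome S-common run)
    S+e⊆T+e : S ∪ ⁅ e ⁆ ⊆ _ ∪ ⁅ e ⁆
    S+e⊆T+e = x∈p∪q⁺ ∘ map₁ grows ∘ x∈p∪q⁻ S ⁅ e ⁆

concat-map-reverse-allFin-suc : ∀ {A : Set} m (σ : Fin (suc m) → List A) →
  concat (map σ (reverse (allFin (suc m)))) ≡ concat (map (σ ∘ suc) (reverse (allFin m))) ++ σ zero
concat-map-reverse-allFin-suc m σ = begin
  concat (map σ (reverse (allFin (suc m))))
    ≡⟨ cong (concat ∘ map σ) (unfold-reverse zero (tabulateₗ suc)) ⟩
  concat (map σ (reverse (tabulateₗ suc) ∷ʳ zero))
    ≡⟨ cong concat (map-++ σ (reverse (tabulateₗ suc)) (zero ∷ [])) ⟩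
  concat (map σ (reverse (tabulateₗ suc)) ∷ʳ σ zero)
    ≡⟨ concat-++ (map σ (reverse (tabulateₗ suc))) (σ zero ∷ []) ⟨
  concat (map σ (reverse (tabulateₗ suc))) ++ (σ zero ++ [])
    ≡⟨ cong₂ _++_ (cong concat upper) (++-identityʳ (σ zero)) ⟩
  concat (map (σ ∘ suc) (reverse (allFin m))) ++ σ zero ∎
  where
  open ≡-Reasoning
  upper : map σ (reverse (tabulateₗ suc)) ≡ map (σ ∘ suc) (reverse (allFin m))
  upper = begin
    map σ (reverse (tabulateₗ suc))         ≡⟨ reverse-map σ (tabulateₗ suc) ⟩
    reverse (map σ (tabulateₗ suc))         ≡⟨ cong reverse (map-tabulate suc σ) ⟩
    reverse (tabulateₗ (σ ∘ suc))           ≡⟨ cong reverse (map-tabulate id (σ ∘ suc)) ⟨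
    reverse (map (σ ∘ suc) (allFin m))     ≡⟨ reverse-map (σ ∘ suc) (allFin m) ⟨
    map (σ ∘ suc) (reverse (allFin m))     ∎

ℚ-ring : AlmostCommutativeRing 0ℓ 0ℓ
ℚ-ring = fromCommutativeRing +-*-commutativeRing (λ q → dec⇒maybe (0ℚ ≟ q))

≤-by-gap : ∀ {p q} d → 0ℚ ≤ d → p + d ≡ q → p ≤ q
≤-by-gap {p} d 0≤d refl = subst (_≤ p + d) (+-identityʳ p) (+-monoʳ-≤ p 0≤d)

p≤q⇒0≤q-p : ∀ {p q} → p ≤ q → 0ℚ ≤ q - p
p≤q⇒0≤q-p {p} {q} p≤q = subst (_≤ q - p) (+-inverseʳ p) (+-monoˡ-≤ (- p) p≤q)

*-nonneg : ∀ {p q} → 0ℚ ≤ p → 0ℚ ≤ q → 0ℚ ≤ p * q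
*-nonneg {p} {q} 0≤p 0≤q =
  nonNegative⁻¹ (p * q) {{nonNeg*nonNeg⇒nonNeg p {{nonNegative 0≤p}} q {{nonNegative 0≤q}}}}

y≤[1+e]y-κ : ∀ e y {κ} → κ ≤ e * y → y ≤ (1ℚ + e) * y - κ
y≤[1+e]y-κ e y {κ} κ≤ey = ≤-by-gap (e * y - κ) (p≤q⇒0≤q-p κ≤ey) (identity e y κ)
  where
  identity : ∀ e y κ → y + (e * y - κ) ≡ (1ℚ + e) * y - κ
  identity = solve-∀ ℚ-ring

a+[z-c]≤z-κ : ∀ a z {κ c} → a + κ ≤ c → a + (z - c) ≤ z - κ
a+[z-c]≤z-κ a z {κ} {c} a+κ≤c = ≤-by-gap (c - (a + κ)) (p≤q⇒0≤q-p a+κ≤c) (identity a κ c z)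
  where
  identity : ∀ a κ c z → a + (z - c) + (c - (a + κ)) ≡ z - κ
  identity = solve-∀ ℚ-ring

z-c≤z-c′ : ∀ z {c c′} → c′ ≤ c → z - c ≤ z - c′
z-c≤z-c′ z c′≤c = +-monoʳ-≤ z (neg-antimono-≤ c′≤c)

0≤4ε : ∀ {ε} → 0ℚ ≤ ε → 0ℚ ≤ + 4 / 1 * ε
0≤4ε = *-nonneg (<⇒≤ (positive⁻¹ (+ 4 / 1)))

spread⇒reserve : ∀ {ε l r l′} → 0ℚ ≤ ε → (+ 4 / 1) * ε ≤ 1ℚ → l ≤ r → r < ε * l′ →
  (r ⊔ 0ℚ) + (r ⊔ 0ℚ) + (+ 4 / 1) * ε * (l ⊔ 0ℚ) ≤ (+ 4 / 1) * ε * (l′ ⊔ 0ℚ)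
spread⇒reserve {ε} {l} {r} {l′} 0≤ε e≤1 l≤r r<εl′ = begin
  r⁺ + r⁺ + e * (l ⊔ 0ℚ)  ≤⟨ +-mono-≤ (+-mono-≤ r⁺≤εl′⁺ r⁺≤εl′⁺) (≤-trans el⁺≤r⁺ r⁺≤εl′⁺) ⟩
  εl′⁺ + εl′⁺ + εl′⁺      ≤⟨ ≤-by-gap εl′⁺ (*-nonneg 0≤ε (p≤q⊔p l′ 0ℚ)) refl ⟩
  εl′⁺ + εl′⁺ + εl′⁺ + εl′⁺ ≡⟨ four-times ε (l′ ⊔ 0ℚ) ⟩
  e * (l′ ⊔ 0ℚ)           ∎
  where
  open ≤-Reasoning
  e r⁺ εl′⁺ : ℚ
  e = + 4 / 1 * ε
  r⁺ = r ⊔ 0ℚ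
  εl′⁺ = ε * (l′ ⊔ 0ℚ)
  r⁺≤εl′⁺ : r⁺ ≤ εl′⁺
  r⁺≤εl′⁺ = ⊔-lub (≤-trans (<⇒≤ r<εl′) (*-monoˡ-≤-nonNeg ε {{nonNegative 0≤ε}} (p≤p⊔q l′ 0ℚ)))
                  (*-nonneg 0≤ε (p≤q⊔p l′ 0ℚ))
  el⁺≤r⁺ : e * (l ⊔ 0ℚ) ≤ r⁺
  el⁺≤r⁺ = begin
    e * (l ⊔ 0ℚ) ≤⟨ *-monoˡ-≤-nonNeg e {{nonNegative (0≤4ε 0≤ε)}} (⊔-monoˡ-≤ 0ℚ l≤r) ⟩
    e * r⁺       ≤⟨ *-monoʳ-≤-nonNeg r⁺ {{nonNegative (p≤q⊔p r 0ℚ)}} e≤1 ⟩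
    1ℚ * r⁺      ≡⟨ *-identityˡ r⁺ ⟩
    r⁺           ∎
  four-times : ∀ ε x → ε * x + ε * x + ε * x + ε * x ≡ (1ℚ + 1ℚ + 1ℚ + 1ℚ) * ε * x
  four-times = solve-∀ ℚ-ring

[1-e]*A≤W : ∀ {e A W} → 0ℚ ≤ e → 0ℚ ≤ A → 0ℚ ≤ W → (e ≤ 1ℚ → A ≤ (1ℚ + e) * W) → (1ℚ - e) * A ≤ W
[1-e]*A≤W {e} {A} {W} 0≤e 0≤A 0≤W charged with e ≤? 1ℚ
... | yes e≤1 = begin
  (1ℚ - e) * A               ≤⟨ *-monoˡ-≤-nonNeg (1ℚ - e) {{nonNegative (p≤q⇒0≤q-p e≤1)}} (charged e≤1) ⟩
  (1ℚ - e) * ((1ℚ + e) * W)  ≡⟨ identity e W ⟨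
  W - e * e * W              ≤⟨ +-monoʳ-≤ W (neg-antimono-≤ (*-nonneg (*-nonneg 0≤e 0≤e) 0≤W)) ⟩
  W - 0ℚ                     ≡⟨ +-identityʳ W ⟩
  W                          ∎
  where
  open ≤-Reasoning
  identity : ∀ e W → W - e * e * W ≡ (1ℚ - e) * ((1ℚ + e) * W)
  identity = solve-∀ ℚ-ring
... | no e≰1 = begin
  (1ℚ - e) * A  ≤⟨ *-monoʳ-≤-nonNeg A {{nonNegative 0≤A}} 1-e≤0 ⟩
  0ℚ * A        ≡⟨ *-zeroˡ A ⟩
  0ℚ            ≤⟨ 0≤W ⟩
  W             ∎
  where
  open ≤-Reasoning
  1-e≤0 : 1ℚ - e ≤ 0ℚ
  1-e≤0 = subst (1ℚ - e ≤_) (+-inverseʳ e) (+-monoˡ-≤ (- e) (<⇒≤ (≰⇒> e≰1)))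

-- The charging argument

module Charging (M₁ M₂ : Matroid n) (w : Fin n → ℚ) (e : ℚ) where

  potential : ℚ → Fin n → ℚ
  potential c x = (1ℚ + e) * w x - c

  Invariant : ℚ → Subset n → ℚ → Set
  Invariant c T A = CommonIndep M₁ M₂ T × A ≤ sumOn T (potential c)

  Invariant-⊥ : ∀ c → Invariant c ⊥ 0ℚ
  Invariant-⊥ c = (indep-∅ M₁ , indep-∅ M₂) , ≤-reflexive (sym (sumOn-⊥ (potential c)))

  Invariant-weaken : ∀ {c c′ T A} → c′ ≤ c → Invariant c T A → Invariant c′ T A
  Invariant-weaken {T = T} c′≤c (T-common , A≤) =
    T-common , ≤-trans A≤ (sumOn-mono T λ {x} _ → z-c≤z-c′ ((1ℚ + e) * w x) c′≤c)

  Invariant⇒charged : ∀ {T A} → Invariant 0ℚ T A → A ≤ (1ℚ + e) * weight w T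
  Invariant⇒charged {T} {A} (_ , A≤) = begin
    A                                ≤⟨ A≤ ⟩
    sumOn T (potential 0ℚ)           ≤⟨ sumOn-mono T (λ _ → ≤-reflexive (+-identityʳ _)) ⟩
    sumOn T (λ x → (1ℚ + e) * w x)   ≡⟨ sumOn-* T (1ℚ + e) ⟩
    (1ℚ + e) * sumOn T w             ≡⟨ cong (_*_ (1ℚ + e)) (weight≡sumOn w T) ⟨
    (1ℚ + e) * weight w T            ∎
    where open ≤-Reasoning

  record Block (I : Subset n) (σ : List (Fin n)) (ρ κ : ℚ) : Set where
    field
      independent : CommonIndep M₁ M₂ I
      σ⊆I         : ∀ {x} → x ∈ₗ σ → x ∈ I
      I⊆σ         : ∀ {x} → x ∈ I → x ∈ₗ σ
      0≤ρ         : 0ℚ ≤ ρ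
      w≤ρ         : ∀ {x} → x ∈ I → w x ≤ ρ
      κ≤ew        : ∀ {x} → x ∈ I → κ ≤ e * w x

  block-step : ∀ {I σ ρ κ c T T′ A} → Block I σ ρ κ → ρ + ρ + κ ≤ c →
               Invariant c T A → Greedy M₁ M₂ T σ T′ → Invariant κ T′ (weight w I + A)
  block-step {I} {_} {ρ} {κ} {c} {T} {T′} {A} block reserve (T-common , A≤) run = common , (begin
    weight w I + A
      ≤⟨ +-mono-≤ weight-I≤ A≤ ⟩
    (sumOn N w + sumOn T (λ _ → ρ + ρ)) + sumOn T (potential c)
      ≡⟨ +-assoc (sumOn N w) _ _ ⟩
    sumOn N w + (sumOn T (λ _ → ρ + ρ) + sumOn T (potential c))
      ≡⟨ cong (_+_ (sumOn N w)) (sumOn-+ T) ⟨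
    sumOn N w + sumOn T (λ x → ρ + ρ + potential c x)
      ≤⟨ +-mono-≤ (sumOn-mono N new≤) (sumOn-mono T old≤) ⟩
    sumOn N (potential κ) + sumOn T (potential κ)
      ≡⟨ +-comm (sumOn N (potential κ)) _ ⟩
    sumOn T (potential κ) + sumOn N (potential κ)
      ≡⟨ sumOn-⊆-split T′ T grows ⟨
    sumOn T′ (potential κ) ∎)
    where
    open ≤-Reasoning
    open Block block
    open GreedyOutcome (greedy-outcome T-common run)
    N : Subset n
    N = T′ ─ T
    N⊆I : N ⊆ I
    N⊆I x∈N = [ flip contradiction (x∈p─q⇒x∉q T′ T x∈N) , σ⊆I ]′ (new-from (p─q⊆p T′ T x∈N))
    rest-count : ∣ I ─ N ∣ ℕ.≤ ∣ T ∣ ℕ.+ ∣ T ∣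
    rest-count = ∣p─[q─r]∣≤∣r∣+∣r∣ I T′ T grows N⊆I
      (maximal⇒∣I∣+∣I∩T∣≤∣T∣+∣T∣ M₁ M₂ independent common (rejected ∘ I⊆σ))
    rest≤ : sumOn (I ─ N) w ≤ sumOn T (λ _ → ρ + ρ)
    rest≤ = begin
      sumOn (I ─ N) w                 ≤⟨ sumOn-mono (I ─ N) (w≤ρ ∘ p─q⊆p I N) ⟩
      sumOn (I ─ N) (λ _ → ρ)         ≡⟨ sumOn-const (I ─ N) ρ ⟩
      ∣ I ─ N ∣ ×′ ρ                  ≤⟨ ×′-monoˡ-≤ 0≤ρ rest-count ⟩
      (∣ T ∣ ℕ.+ ∣ T ∣) ×′ ρ          ≡⟨ ×-homo-+ ρ (∣ T ∣) (∣ T ∣) ⟩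
      ∣ T ∣ ×′ ρ + ∣ T ∣ ×′ ρ         ≡⟨ cong₂ _+_ (sumOn-const T ρ) (sumOn-const T ρ) ⟨
      sumOn T (λ _ → ρ) + sumOn T (λ _ → ρ) ≡⟨ sumOn-+ T ⟨
      sumOn T (λ _ → ρ + ρ)           ∎
    weight-I≤ : weight w I ≤ sumOn N w + sumOn T (λ _ → ρ + ρ)
    weight-I≤ = begin
      weight w I                  ≡⟨ weight≡sumOn w I ⟩
      sumOn I w                   ≡⟨ sumOn-⊆-split I N N⊆I ⟩
      sumOn N w + sumOn (I ─ N) w ≤⟨ +-monoʳ-≤ (sumOn N w) rest≤ ⟩
      sumOn N w + sumOn T (λ _ → ρ + ρ) ∎
    new≤ : ∀ {x} → x ∈ N → w x ≤ potential κ x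
    new≤ {x} = y≤[1+e]y-κ e (w x) ∘ κ≤ew ∘ N⊆I
    old≤ : ∀ {x} → x ∈ T → ρ + ρ + potential c x ≤ potential κ x
    old≤ {x} _ = a+[z-c]≤z-κ (ρ + ρ) ((1ℚ + e) * w x) reserve

  blocks-invariant : ∀ k (I : Fin k → Subset n) (σ : Fin k → List (Fin n)) (ρ κ : Fin k → ℚ) →
    (∀ j → Block (I j) (σ j) (ρ j) (κ j)) →
    (∀ i j → suc (toℕ i) ≡ toℕ j → ρ i + ρ i + κ i ≤ κ j) →
    ∀ c → (∀ j → toℕ j ≡ 0 → c ≤ κ j) →
    ∀ {T} → Greedy M₁ M₂ ⊥ (concat (map σ (reverse (allFin k)))) T →
    Invariant c T (ΣFin k (λ j → weight w (I j)))
  blocks-invariant zero    _ _ _ _ _ _ c _ done = Invariant-⊥ c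
  blocks-invariant (suc k) I σ ρ κ block chain c c≤κ₀ run
    with greedy-++ (concat (map (σ ∘ suc) (reverse (allFin k)))) (σ zero)
                   (subst (λ xs → Greedy M₁ M₂ ⊥ xs _) (concat-map-reverse-allFin-suc k σ) run)
  ... | U , upper-run , lowest-run =
    Invariant-weaken (c≤κ₀ zero refl) (block-step (block zero) ≤-refl upper lowest-run)
    where
    upper : Invariant (ρ zero + ρ zero + κ zero) U (ΣFin k (λ j → weight w (I (suc j))))
    upper = blocks-invariant k (I ∘ suc) (σ ∘ suc) (ρ ∘ suc) (κ ∘ suc) (block ∘ suc)
      (λ i j i+1≡j → chain (suc i) (suc j) (cong suc i+1≡j))
      (ρ zero + ρ zero + κ zero) (λ j j≡0 → chain zero (suc j) (cong suc (sym j≡0)))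
      upper-run

lemma6 : (n k : ℕ) (ε : ℚ) → 0ℚ < ε →
    (M₁ M₂ : Matroid n) (w : Fin n → ℚ) → (∀ e → 0ℚ < w e) →
    (l r : Fin k → ℚ) → (∀ j → l j ≤ r j) →
    (∀ i j → suc (toℕ i) ≡ toℕ j → r i < ε * l j) →
    (∀ e → Σ (Fin k) λ j → l j ≤ w e × w e ≤ r j) →
    (L : Fin k → Subset n) → (∀ j → InInterval w (l j) (r j) (L j)) →
    (I' : Fin k → Subset n) →
    (∀ j → IndepRestr M₁ (L j) (I' j) × IndepRestr M₂ (L j) (I' j)) →
    (σ : Fin k → List (Fin n)) → (∀ j e → (e ∈ₗ σ j → e ∈ I' j) × (e ∈ I' j → e ∈ₗ σ j)) →
    (Imerge : Subset n) →
    Greedy M₁ M₂ ⊥ (concat (map σ (reverse (allFin k)))) Imerge →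
    weight w Imerge ≥ (1ℚ - (+ 4 / 1) * ε) * ΣFin k (λ j → weight w (I' j))
lemma6 _ k ε 0<ε M₁ M₂ w 0<w l r l≤r spread _ _ L-interval I' I'-indep σ σ-lists Imerge run =
  [1-e]*A≤W 0≤e (ΣFin-nonneg k (weight-nonneg 0<w ∘ I')) (weight-nonneg 0<w Imerge) λ e≤1 →
    Invariant⇒charged (blocks-invariant k I' σ ρ κ block
      (λ i j i+1≡j → spread⇒reserve (<⇒≤ 0<ε) e≤1 (l≤r i) (spread i j i+1≡j))
      0ℚ (λ j _ → *-nonneg 0≤e (p≤q⊔p (l j) 0ℚ)) run)
  where
  e : ℚ
  e = + 4 / 1 * ε
  open Charging M₁ M₂ w e
  0≤e : 0ℚ ≤ e
  0≤e = 0≤4ε (<⇒≤ 0<ε)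
  ρ κ : Fin k → ℚ
  ρ j = r j ⊔ 0ℚ
  κ j = e * (l j ⊔ 0ℚ)
  block : ∀ j → Block (I' j) (σ j) (ρ j) (κ j)
  block j = record
    { independent = proj₁ (proj₁ (I'-indep j)) , proj₁ (proj₂ (I'-indep j))
    ; σ⊆I         = proj₁ (σ-lists j _)
    ; I⊆σ         = proj₂ (σ-lists j _)
    ; 0≤ρ         = p≤q⊔p (r j) 0ℚ
    ; w≤ρ         = λ x∈I → ≤-trans (proj₂ (in-interval x∈I)) (p≤p⊔q (r j) 0ℚ)
    ; κ≤ew        = λ {x} x∈I →
        *-monoˡ-≤-nonNeg e {{nonNegative 0≤e}} (⊔-lub (proj₁ (in-interval x∈I)) (<⇒≤ (0<w x)))
    }
    where
    in-interval : ∀ {x} → x ∈ I' j → l j ≤ w x × w x ≤ r j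
    in-interval {x} x∈I = proj₁ (L-interval j x) (proj₂ (proj₁ (I'-indep j)) x∈I)
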